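{- Let $n\ge 2$ and let $f$ be a nested canalyzing function in $n$ variables with layer number $r$ and profile $[k_1,\dots,k_r]$. If $r=1$ then $s(f)=n$. If $r>1$ then $$s(f)=\begin{cases}\max\{k_1+k_3+\dots+k_r,\ k_2+k_4+\dots+k_{r-1}+1\}, & r \text{ odd},\\ \max\{k_1+k_3+\dots+k_{r-1}+1,\ k_2+k_4+\dots+k_r\}, & r \text{ even}.\end{cases}$$
   Context: Work over $\mathbb{F}_2$, $\oplus$ is addition mod 2 and $\overline{a}=a\oplus 1$. A Boolean function $f:\mathbb{F}_2^n\to\mathbb{F}_2$ is nested canalyzing (NCF) in the variable order $x_{\sigma(1)},\dots,x_{\sigma(n)}$ ($\sigma$ a permutation of $\{1,\dots,n\}$) with canalyzing inputs $a_1,\dots,a_n$ and canalyzed values $b_1,\dots,b_n$ if $f=b_1$ when $x_{\sigma(1)}=a_1$; $f=b_k$ when $x_{\sigma(j)}=\overline{a_j}$ for $j<k$ and $x_{\sigma(k)}=a_k$ ($k=2,\dots,n$); and $f=\overline{b_n}$ when $x_{\sigma(j)}=\overline{a_j}$ for all $j$. $f$ is an NCF if this holds for some $\sigma$. It is known that for $n\ge2$ every NCF can be written uniquely as $f=M_1(M_2(\cdots(M_{r-1}(M_r\oplus1)\oplus1)\cdots)\oplus1)\oplus b$, where $M_i=\prod_{j=1}^{k_i}(x_{i_j}\oplus a_{i_j})$, $k_i\ge1$ for $i<r$, $k_r\ge2$, $k_1+\dots+k_r=n$, $a_{i_j},b\in\mathbb{F}_2$, and the variables $x_{i_j}$ are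 exactly $x_1,\dots,x_n$, each once. The number $r$ is the layer number of $f$ and $[k_1,\dots,k_r]$ its profile. The sensitivity of $f$ at $\mathbf{x}$, $s(f;\mathbf{x})$, is the number of $i$ such that flipping the $i$-th bit of $\mathbf{x}$ changes the value of $f$; $s(f)=\max_{\mathbf{x}}s(f;\mathbf{x})$. -}

module Defs where

open import Data.Bool using (Bool; true; false; not; _∧_; _xor_; if_then_else_)
open import Data.Nat using (ℕ; zero; suc; _+_; _≤_; _<_; _⊔_)
open import Data.Fin using (Fin; toℕ; _≟_)
open import Relation.Nullary.Decidable using (⌊_⌋)
open import Data.Empty using (⊥)
open import Data.Fin.Permutation using (Permutation′; _⟨$⟩ʳ_)
open import Data.List using (List; []; _∷_; map; foldr; take; drop; allFin; concatMap; length)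
open import Data.Nat.ListAction using (sum)
open import Data.Bool.ListAction using (and)
open import Data.List.Relation.Unary.All using (All)
open import Data.Vec.Functional using (Vector) renaming (_∷_ to _∷ᶠ_)
open import Data.Product using (Σ; _×_; _,_)
open import Relation.Binary.PropositionalEquality using (_≡_)

BoolFun : ℕ → Set
BoolFun n = (Fin n → Bool) → Bool

flipBit : ∀ {n} → Fin n → (Fin n → Bool) → (Fin n → Bool)
flipBit i x j = if ⌊ i ≟ j ⌋ then not (x j) else x j

sensAt : ∀ {n} → BoolFun n → (Fin n → Bool) → ℕ
sensAt {n} f x = sum (map (λ i → if f (flipBit i x) xor f x then 1 else 0) (allFin n))

allInputs : (n : ℕ) → List (Fin n → Bool)
allInputs zero = (λ ()) ∷ []
allInputs (suc n) = concatMap (λ v → (false ∷ᶠ v) ∷ (true ∷ᶠ v) ∷ []) (allInputs n)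

sensitivity : ∀ {n} → BoolFun n → ℕ
sensitivity {n} f = foldr _⊔_ 0 (map (sensAt f) (allInputs n))

-- Nested canalyzing function, as in the definition: order σ, canalyzing
-- inputs a_k and canalyzed values b_k indexed by position k in the order.
IsNCF : ∀ {n} → BoolFun n → Set
IsNCF {n} f =
  Σ (Permutation′ n) λ σ → Σ (Fin n → Bool) λ a → Σ (Fin n → Bool) λ b →
    (∀ x (k : Fin n) → (∀ (j : Fin n) → toℕ j < toℕ k → x (σ ⟨$⟩ʳ j) ≡ not (a j))
        → x (σ ⟨$⟩ʳ k) ≡ a k → f x ≡ b k)
  × (∀ x → (∀ (j : Fin n) → x (σ ⟨$⟩ʳ j) ≡ not (a j))
        → (k : Fin n) → suc (toℕ k) ≡ n → f x ≡ not (b k))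

LastAtLeast2 : List ℕ → Set
LastAtLeast2 [] = ⊥
LastAtLeast2 (k ∷ []) = 2 ≤ k
LastAtLeast2 (_ ∷ k ∷ ks) = LastAtLeast2 (k ∷ ks)

ValidProfile : ℕ → List ℕ → Set
ValidProfile n ks = All (1 ≤_) ks × LastAtLeast2 ks × sum ks ≡ n

-- Given the profile and the list of values (x_{i_j} ⊕ a_{i_j}) in layer order,
-- computes M_1(M_2(⋯(M_{r-1}(M_r ⊕ 1) ⊕ 1)⋯) ⊕ 1).
nest : List ℕ → List Bool → Bool
nest [] vs = true
nest (k ∷ []) vs = and (take k vs)
nest (k ∷ k' ∷ ks) vs = and (take k vs) ∧ not (nest (k' ∷ ks) (drop k vs))

-- The normal form with profile ks: the variables x_{i_j} listed in layer order
-- are x_{σ(0)}, …, x_{σ(n-1)}; a gives a_{i} for variable x_i; b is the constant.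
normalForm : ∀ {n} → List ℕ → Permutation′ n → (Fin n → Bool) → Bool → BoolFun n
normalForm {n} ks σ a b x =
  nest ks (map (λ j → x (σ ⟨$⟩ʳ j) xor a (σ ⟨$⟩ʳ j)) (allFin n)) xor b

HasProfile : ∀ {n} → BoolFun n → List ℕ → Set
HasProfile {n} f ks =
  ValidProfile n ks ×
  Σ (Permutation′ n) λ σ → Σ (Fin n → Bool) λ a → Σ Bool λ b →
    (∀ x → f x ≡ normalForm ks σ a b x)

oddSum evenSum : List ℕ → ℕ
oddSum [] = 0
oddSum (k ∷ ks) = k + evenSum ks
evenSum [] = 0
evenSum (k ∷ ks) = oddSum ks

isOddLength : List ℕ → Bool
isOddLength [] = false
isOddLength (_ ∷ ks) = not (isOddLength ks)

sensFormula : List ℕ → ℕ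
sensFormula ks =
  if isOddLength ks then oddSum ks ⊔ suc (evenSum ks)
                    else suc (oddSum ks) ⊔ evenSum ks

module Submission where

-- After the change of variables
-- x ↦ (x_{σ(j)} ⊕ a_{σ(j)})_j the function becomes  nest ks  xor b, and
-- neither the reordering σ, the shift a nor the constant b changes the
-- sensitivity at corresponding points.  So everything reduces to the list
-- function  nest ks = M₁ ∧ ¬(nest rest),  whose sensitivity we compute by
-- induction on the profile: on the block u of the first layer only the
-- conjunction M₁ = and u can be sensitive, on the remaining block w only the
-- inner function can, and each only when the other factor allows it.  This
-- gives, for each output value c, a bound  peak ks c  on the sensitivity
-- at points where the value is c, and the bound is attained.

open import Defs
open import Data.Bool using (Bool; true; false; not; _∧_; _xor_; if_then_else_)
open import Data.Bool.Properties
  using (∧-identityʳ; ∧-zeroʳ; not-distribˡ-xor; xor-assoc; xor-same; xor-identityʳ)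
open import Data.Bool.ListAction using (and)
open import Data.Nat using (ℕ; zero; suc; _+_; _∸_; _≤_; _⊔_; _⊓_; z≤n; s≤s)
open import Data.Nat.Properties
  using (≤-refl; ≤-trans; ≤-reflexive; ≤-antisym; +-assoc; +-suc; +-identityʳ; +-mono-≤;
         m≤m+n; m≤n⇒m⊓n≡m; m+n∸m≡n; ⊔-lub; m≤m⊔n; m≤n⊔m; m≤n⇒m≤n⊔o; m≤n⇒m≤o⊔n;
         m≥n⇒m⊔n≡m; +-0-commutativeMonoid)
open import Data.Nat.ListAction using (sum)
open import Data.Fin using (Fin; zero; suc; _≟_)
open import Data.Fin.Permutation using (Permutation′; _⟨$⟩ʳ_; _⟨$⟩ˡ_; inverseˡ; inverseʳ; flip)
open import Data.List
  using (List; []; _∷_; map; take; drop; _++_; replicate; tabulate; lookup; allFin; length)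
open import Data.List.Properties
  using (length-++; length-replicate; length-take; length-drop; take++drop≡id;
         tabulate-cong; map-tabulate; length-tabulate; tabulate-lookup; map-cong;
         foldr-preservesᵇ; foldr-preservesᵒ)
open import Data.List.Relation.Unary.All using (All; []; _∷_; universal)
import Data.List.Relation.Unary.All.Properties as All
open import Data.List.Relation.Unary.Any using (here; there)
import Data.List.Relation.Unary.Any as Any
import Data.List.Relation.Unary.Any.Properties as Any
open import Data.List.Membership.Propositional using (_∈_)
open import Data.List.Membership.Propositional.Properties using (∈-concatMap⁺)
open import Data.Vec.Functional using () renaming (_∷_ to _∷ᶠ_)
open import Data.Product using (Σ; ∃; _×_; _,_)
open import Data.Sum using ([_,_]; inj₂)
open import Relation.Nullary.Decidable using (⌊_⌋; yes; no)
open import Relation.Nullary.Negation using (contradiction)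
open import Relation.Binary.PropositionalEquality
  using (_≡_; _≗_; refl; sym; trans; cong; cong₂; subst; module ≡-Reasoning)
import Algebra.Properties.CommutativeMonoid.Sum as CommutativeMonoidSum

open CommutativeMonoidSum +-0-commutativeMonoid using (sum-permute; sum-cong-≗) renaming (sum to ∑)

not-xor-not : ∀ p q → not p xor not q ≡ p xor q
not-xor-not true  true  = refl
not-xor-not true  false = refl
not-xor-not false true  = refl
not-xor-not false false = refl

xor-cancelʳ : ∀ p q b → (p xor b) xor (q xor b) ≡ p xor q
xor-cancelʳ true  true  b     = xor-same (not b)
xor-cancelʳ false false b     = xor-same b
xor-cancelʳ true  false true  = refl
xor-cancelʳ true  false false = refl
xor-cancelʳ false true  true  = refl
xor-cancelʳ false true  false = refl

xor-involutiveʳ : ∀ p a → (p xor a) xor a ≡ p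
xor-involutiveʳ p a = trans (xor-assoc p a a) (trans (cong (p xor_) (xor-same a)) (xor-identityʳ p))

ind : Bool → ℕ
ind b = if b then 1 else 0

listSens : (List Bool → Bool) → List Bool → ℕ
listSens h []      = 0
listSens h (b ∷ v) = ind (h (not b ∷ v) xor h (b ∷ v)) + listSens (λ w → h (b ∷ w)) v

listSens-cong : ∀ {h h′ : List Bool → Bool} v →
  (∀ w → length w ≡ length v → h w ≡ h′ w) → listSens h v ≡ listSens h′ v
listSens-cong []      e = refl
listSens-cong (b ∷ v) e =
  cong₂ _+_ (cong ind (cong₂ _xor_ (e _ refl) (e _ refl)))
            (listSens-cong v (λ w l → e (b ∷ w) (cong suc l)))

listSens-const : ∀ c v → listSens (λ _ → c) v ≡ 0
listSens-const c []      = refl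
listSens-const c (b ∷ v) rewrite xor-same c = listSens-const c v

listSens-not : ∀ h v → listSens (λ w → not (h w)) v ≡ listSens h v
listSens-not h []      = refl
listSens-not h (b ∷ v) =
  cong₂ _+_ (cong ind (not-xor-not (h (not b ∷ v)) (h (b ∷ v)))) (listSens-not _ v)

listSens-++ : ∀ h u w →
  listSens h (u ++ w) ≡ listSens (λ u′ → h (u′ ++ w)) u + listSens (λ w′ → h (u ++ w′)) w
listSens-++ h []      w = refl
listSens-++ h (b ∷ u) w =
  trans (cong (ind (h (not b ∷ u ++ w) xor h (b ∷ u ++ w)) +_) (listSens-++ (λ v → h (b ∷ v)) u w))
        (sym (+-assoc (ind (h (not b ∷ u ++ w) xor h (b ∷ u ++ w))) _ _))

listSens-∧ʳ : ∀ h c v → listSens (λ w → h w ∧ c) v ≡ (if c then listSens h v else 0)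
listSens-∧ʳ h true  v = listSens-cong v (λ w _ → ∧-identityʳ (h w))
listSens-∧ʳ h false v = trans (listSens-cong v (λ w _ → ∧-zeroʳ (h w))) (listSens-const false v)

listSens-∧ˡ : ∀ c h v → listSens (λ w → c ∧ h w) v ≡ (if c then listSens h v else 0)
listSens-∧ˡ true  h v = refl
listSens-∧ˡ false h v = listSens-const false v

and-sens-true : ∀ u → and u ≡ true → listSens and u ≡ length u
and-sens-true []         e = refl
and-sens-true (true ∷ u) e rewrite e = cong suc (and-sens-true u e)

and-sens-false : ∀ u → and u ≡ false → listSens and u ≤ 1
and-sens-false (true ∷ u)  e rewrite e = and-sens-false u e
and-sens-false (false ∷ u) e rewrite listSens-const false u with and u
... | true  = ≤-refl
... | false = z≤n

and-replicate : ∀ k → and (replicate k true) ≡ true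
and-replicate zero    = refl
and-replicate (suc k) = and-replicate k

and-sens-replicate : ∀ k → listSens and (replicate k true) ≡ k
and-sens-replicate k = trans (and-sens-true (replicate k true) (and-replicate k)) (length-replicate k)

innerNest : List ℕ → List Bool → Bool
innerNest []       _ = false
innerNest (k ∷ ks) v = nest (k ∷ ks) v

nest-cons : ∀ k rest v → nest (k ∷ rest) v ≡ and (take k v) ∧ not (innerNest rest (drop k v))
nest-cons k []       v = sym (∧-identityʳ (and (take k v)))
nest-cons k (_ ∷ _)  v = refl

nest-++ : ∀ k rest u w → length u ≡ k → nest (k ∷ rest) (u ++ w) ≡ and u ∧ not (innerNest rest w)
nest-++ k rest u w refl =
  trans (nest-cons (length u) rest (u ++ w))
        (cong₂ (λ u′ w′ → and u′ ∧ not (innerNest rest w′)) (take-length u) (drop-length u))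
  where
  take-length : ∀ u → take (length u) (u ++ w) ≡ u
  take-length []      = refl
  take-length (b ∷ u) = cong (b ∷_) (take-length u)
  drop-length : ∀ u → drop (length u) (u ++ w) ≡ w
  drop-length []      = refl
  drop-length (b ∷ u) = drop-length u

nest-sens-++ : ∀ k rest u w → length u ≡ k →
  listSens (nest (k ∷ rest)) (u ++ w)
    ≡ (if not (innerNest rest w) then listSens and u else 0)
      + (if and u then listSens (innerNest rest) w else 0)
nest-sens-++ k rest u w lu = begin
    listSens (nest (k ∷ rest)) (u ++ w)
  ≡⟨ listSens-++ (nest (k ∷ rest)) u w ⟩
    listSens (λ u′ → nest (k ∷ rest) (u′ ++ w)) u + listSens (λ w′ → nest (k ∷ rest) (u ++ w′)) w
  ≡⟨ cong₂ _+_ (listSens-cong u (λ u′ l → nest-++ k rest u′ w (trans l lu)))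
               (listSens-cong w (λ w′ _ → nest-++ k rest u w′ lu)) ⟩
    listSens (λ u′ → and u′ ∧ not (innerNest rest w)) u
      + listSens (λ w′ → and u ∧ not (innerNest rest w′)) w
  ≡⟨ cong₂ _+_ (listSens-∧ʳ and (not (innerNest rest w)) u)
               (trans (listSens-∧ˡ (and u) _ w) (cong (if and u then_else 0) (listSens-not (innerNest rest) w))) ⟩
    (if not (innerNest rest w) then listSens and u else 0)
      + (if and u then listSens (innerNest rest) w else 0)
  ∎
  where open ≡-Reasoning

-- peak ks c bounds the sensitivity of  innerNest ks  at inputs where it takes
-- the value c.  (peak [] true = 1 never occurs as a value of innerNest [],
-- but makes  peak (k ∷ []) false = 1, the sensitivity of a false conjunction.)
peak : List ℕ → Bool → ℕ
peak []       true  = 1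
peak []       false = 0
peak (k ∷ ks) true  = k + peak ks false
peak (k ∷ ks) false = peak ks true

-- With all layers nonempty, a true value can always be made false by one flip.
peak-pos : ∀ ks → All (1 ≤_) ks → 1 ≤ peak ks true
peak-pos []       []      = ≤-refl
peak-pos (k ∷ ks) (p ∷ _) = ≤-trans p (m≤m+n k _)

nest-sens-bound : ∀ ks → All (1 ≤_) ks → ∀ v → length v ≡ sum ks →
  listSens (innerNest ks) v ≤ peak ks (innerNest ks v)
nest-sens-bound [] [] v _ = ≤-reflexive (listSens-const false v)
nest-sens-bound (k ∷ rest) (_ ∷ ps) v lv =
  subst (λ v → listSens (nest (k ∷ rest)) v ≤ peak (k ∷ rest) (nest (k ∷ rest) v))
        (take++drop≡id k v) (bound-at (take k v) (drop k v) lu lw)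
  where
  lu : length (take k v) ≡ k
  lu = trans (length-take k v) (trans (cong (k ⊓_) lv) (m≤n⇒m⊓n≡m (m≤m+n k (sum rest))))
  lw : length (drop k v) ≡ sum rest
  lw = trans (length-drop k v) (trans (cong (_∸ k) lv) (m+n∸m≡n k (sum rest)))
  bound-at : ∀ u w → length u ≡ k → length w ≡ sum rest →
    listSens (nest (k ∷ rest)) (u ++ w) ≤ peak (k ∷ rest) (nest (k ∷ rest) (u ++ w))
  bound-at u w lu lw rewrite nest-sens-++ k rest u w lu | nest-++ k rest u w lu
    with and u in au | innerNest rest w | nest-sens-bound rest ps w lw
  ... | true  | true  | ih = ih
  ... | true  | false | ih = +-mono-≤ (≤-reflexive (trans (and-sens-true u au) lu)) ih
  ... | false | true  | _  = z≤n
  ... | false | false | _  =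
    ≤-trans (≤-reflexive (+-identityʳ _)) (≤-trans (and-sens-false u au) (peak-pos rest ps))

Witness : List ℕ → Bool → Set
Witness ks c =
  Σ (List Bool) λ v → length v ≡ sum ks × innerNest ks v ≡ c × listSens (innerNest ks) v ≡ peak ks c

-- Prefixing a block of k true bits to a witness for value c gives a witness
-- for value not c one layer up.
witness-extend : ∀ k rest c → Witness rest c → Witness (k ∷ rest) (not c)
witness-extend k rest c (w , lw , wc , ws) =
  u ++ w , trans (length-++ u) (cong₂ _+_ (length-replicate k) lw) , value , sens c wc ws
  where
  u = replicate k true
  value : nest (k ∷ rest) (u ++ w) ≡ not c
  value rewrite nest-++ k rest u w (length-replicate k) | and-replicate k | wc = refl
  sens : ∀ d → innerNest rest w ≡ d → listSens (innerNest rest) w ≡ peak rest d →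
    listSens (nest (k ∷ rest)) (u ++ w) ≡ peak (k ∷ rest) (not d)
  sens d wd ws rewrite nest-sens-++ k rest u w (length-replicate k) | and-replicate k | wd with d
  ... | true  = ws
  ... | false = cong₂ _+_ (and-sens-replicate k) ws

witness-single-false : ∀ k → 1 ≤ k → Witness (k ∷ []) false
witness-single-false (suc k) _ =
  u ++ [] , trans (length-++ u) (cong suc (cong (_+ 0) (length-replicate k))) , value , sens
  where
  u = false ∷ replicate k true
  value : nest (suc k ∷ []) (u ++ []) ≡ false
  value = nest-++ (suc k) [] u [] (cong suc (length-replicate k))
  sens : listSens (nest (suc k ∷ [])) (u ++ []) ≡ 1
  sens rewrite nest-sens-++ (suc k) [] u [] (cong suc (length-replicate k))
             | and-replicate k | listSens-const false (replicate k true) = refl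

nest-sens-attained : ∀ k rest → All (1 ≤_) (k ∷ rest) → ∀ c → Witness (k ∷ rest) c
nest-sens-attained k []         _        true  = witness-extend k [] false ([] , refl , refl , refl)
nest-sens-attained k []         (p ∷ []) false = witness-single-false k p
nest-sens-attained k (k′ ∷ r)  (_ ∷ ps) true  =
  witness-extend k (k′ ∷ r) false (nest-sens-attained k′ r ps false)
nest-sens-attained k (k′ ∷ r)  (_ ∷ ps) false =
  witness-extend k (k′ ∷ r) true (nest-sens-attained k′ r ps true)

sum-allFin : ∀ n (t : Fin n → ℕ) → sum (map t (allFin n)) ≡ ∑ t
sum-allFin n t = trans (cong sum (map-tabulate (λ i → i) t)) (sum-tabulate n t)
  where
  sum-tabulate : ∀ n (t : Fin n → ℕ) → sum (tabulate t) ≡ ∑ t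
  sum-tabulate zero    t = refl
  sum-tabulate (suc n) t = cong (t zero +_) (sum-tabulate n (λ i → t (suc i)))

≟-suc : ∀ {n} (i j : Fin n) → ⌊ suc i ≟ suc j ⌋ ≡ ⌊ i ≟ j ⌋
≟-suc i j with i ≟ j
... | yes _ = refl
... | no  _ = refl

listSens-tabulate : ∀ n h (g : Fin n → Bool) →
  listSens h (tabulate g) ≡ ∑ (λ j → ind (h (tabulate (flipBit j g)) xor h (tabulate g)))
listSens-tabulate zero    h g = refl
listSens-tabulate (suc n) h g =
  cong (ind (h (not (g zero) ∷ tabulate (λ j → g (suc j))) xor h (tabulate g)) +_)
    (trans (listSens-tabulate n (λ w → h (g zero ∷ w)) (λ j → g (suc j)))
           (sum-cong-≗ (λ j → cong (λ w → ind (h (g zero ∷ w) xor h (tabulate g))) (flip-suc j))))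
  where
  flip-suc : ∀ j → tabulate (flipBit j (λ i → g (suc i))) ≡ tabulate (λ i → flipBit (suc j) g (suc i))
  flip-suc j = tabulate-cong (λ i → cong (λ d → if d then not (g (suc i)) else g (suc i)) (sym (≟-suc j i)))

layerInput : ∀ {n} → Permutation′ n → (Fin n → Bool) → (Fin n → Bool) → Fin n → Bool
layerInput σ a x j = x (σ ⟨$⟩ʳ j) xor a (σ ⟨$⟩ʳ j)

normalForm-layers : ∀ {n} ks (σ : Permutation′ n) a b x →
  normalForm ks σ a b x ≡ nest ks (tabulate (layerInput σ a x)) xor b
normalForm-layers ks σ a b x = cong (λ v → nest ks v xor b) (map-tabulate (λ j → j) _)

≟-permute : ∀ {n} (σ : Permutation′ n) i j → ⌊ i ≟ σ ⟨$⟩ʳ j ⌋ ≡ ⌊ σ ⟨$⟩ˡ i ≟ j ⌋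
≟-permute σ i j with i ≟ σ ⟨$⟩ʳ j | σ ⟨$⟩ˡ i ≟ j
... | yes _  | yes _  = refl
... | no  _  | no  _  = refl
... | yes e  | no ne  = contradiction (trans (cong (σ ⟨$⟩ˡ_) e) (inverseˡ σ)) ne
... | no ne  | yes e  = contradiction (trans (sym (inverseʳ σ)) (cong (σ ⟨$⟩ʳ_) e)) ne

layerInput-flip : ∀ {n} (σ : Permutation′ n) a x i →
  layerInput σ a (flipBit i x) ≗ flipBit (σ ⟨$⟩ˡ i) (layerInput σ a x)
layerInput-flip σ a x i j with ⌊ i ≟ σ ⟨$⟩ʳ j ⌋ | ⌊ σ ⟨$⟩ˡ i ≟ j ⌋ | ≟-permute σ i j
... | true  | .true  | refl = sym (not-distribˡ-xor (x (σ ⟨$⟩ʳ j)) (a (σ ⟨$⟩ʳ j)))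
... | false | .false | refl = refl

sensAt-layers : ∀ {n} (σ : Permutation′ n) a b (h : List Bool → Bool) (f : BoolFun n) →
  (∀ x → f x ≡ h (tabulate (layerInput σ a x)) xor b) →
  ∀ x → sensAt f x ≡ listSens h (tabulate (layerInput σ a x))
sensAt-layers {n} σ a b h f hf x = begin
    sensAt f x
  ≡⟨ sum-allFin n (λ i → ind (f (flipBit i x) xor f x)) ⟩
    ∑ (λ i → ind (f (flipBit i x) xor f x))
  ≡⟨ sum-cong-≗ term ⟩
    ∑ (λ i → c (σ ⟨$⟩ˡ i))
  ≡⟨ sym (sum-permute c (flip σ)) ⟩
    ∑ c
  ≡⟨ sym (listSens-tabulate n h g) ⟩
    listSens h (tabulate g)
  ∎
  where
  open ≡-Reasoning
  g = layerInput σ a x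
  c : Fin n → ℕ
  c j = ind (h (tabulate (flipBit j g)) xor h (tabulate g))
  term : ∀ i → ind (f (flipBit i x) xor f x) ≡ c (σ ⟨$⟩ˡ i)
  term i = cong ind (begin
      f (flipBit i x) xor f x
    ≡⟨ cong₂ _xor_ (hf (flipBit i x)) (hf x) ⟩
      (h (tabulate (layerInput σ a (flipBit i x))) xor b) xor (h (tabulate g) xor b)
    ≡⟨ xor-cancelʳ (h (tabulate (layerInput σ a (flipBit i x)))) (h (tabulate g)) b ⟩
      h (tabulate (layerInput σ a (flipBit i x))) xor h (tabulate g)
    ≡⟨ cong (λ v → h v xor h (tabulate g)) (tabulate-cong (layerInput-flip σ a x i)) ⟩
      h (tabulate (flipBit (σ ⟨$⟩ˡ i) g)) xor h (tabulate g)
    ∎)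

layerInput-onto : ∀ {n} (σ : Permutation′ n) a v → length v ≡ n →
  Σ (Fin n → Bool) λ x → tabulate (layerInput σ a x) ≡ v
layerInput-onto σ a v refl = (λ i → lookup v (σ ⟨$⟩ˡ i) xor a i) ,
  trans (tabulate-cong (λ j → trans (xor-involutiveʳ _ _) (cong (lookup v) (inverseˡ σ)))) (tabulate-lookup v)

allInputs-complete : ∀ n (x : Fin n → Bool) → ∃ λ y → y ∈ allInputs n × y ≗ x
allInputs-complete zero    x = (λ ()) , here refl , λ ()
allInputs-complete (suc n) x with allInputs-complete n (λ i → x (suc i))
... | y , y∈ , y≗ =
  (x zero ∷ᶠ y) , ∈-concatMap⁺ extensions (Any.map (λ { refl → pair (x zero) }) y∈) , agree
  where
  extensions : (Fin n → Bool) → List (Fin (suc n) → Bool)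
  extensions v = (false ∷ᶠ v) ∷ (true ∷ᶠ v) ∷ []
  pair : ∀ c → (c ∷ᶠ y) ∈ extensions y
  pair false = here refl
  pair true  = there (here refl)
  agree : (x zero ∷ᶠ y) ≗ x
  agree zero    = refl
  agree (suc i) = y≗ i

sensitivity-≤ : ∀ {n} (f : BoolFun n) {m} → (∀ x → sensAt f x ≤ m) → sensitivity f ≤ m
sensitivity-≤ {n} f {m} bound =
  foldr-preservesᵇ {P = _≤ m} {f = _⊔_} ⊔-lub z≤n (All.map⁺ (universal bound (allInputs n)))

sensAt-resp : ∀ {n} (f : BoolFun n) → (∀ {x y} → x ≗ y → f x ≡ f y) →
  ∀ {x y} → x ≗ y → sensAt f x ≡ sensAt f y
sensAt-resp {n} f f-resp {x} {y} x≗y =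
  cong sum (map-cong (λ i → cong₂ (λ p q → ind (p xor q)) (f-resp (flip-resp i)) (f-resp x≗y)) (allFin n))
  where
  flip-resp : ∀ i → flipBit i x ≗ flipBit i y
  flip-resp i j = cong (λ c → if ⌊ i ≟ j ⌋ then not c else c) (x≗y j)

sensAt≤sensitivity : ∀ {n} (f : BoolFun n) → (∀ {x y} → x ≗ y → f x ≡ f y) →
  ∀ x → sensAt f x ≤ sensitivity f
sensAt≤sensitivity {n} f f-resp x with allInputs-complete n x
... | y , y∈ , y≗x =
  ≤-trans (≤-reflexive (sensAt-resp f f-resp (λ i → sym (y≗x i))))
    (foldr-preservesᵒ {P = sensAt f y ≤_} {f = _⊔_} (λ p q → [ m≤n⇒m≤n⊔o q , m≤n⇒m≤o⊔n p ]) 0 _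
      (inj₂ (Any.map⁺ (Any.map (λ { refl → ≤-refl }) y∈))))

normalForm-resp : ∀ {n} ks (σ : Permutation′ n) a b → ∀ {x y} → x ≗ y →
  normalForm ks σ a b x ≡ normalForm ks σ a b y
normalForm-resp {n} ks σ a b x≗y =
  cong (λ v → nest ks v xor b) (map-cong (λ j → cong (_xor a (σ ⟨$⟩ʳ j)) (x≗y (σ ⟨$⟩ʳ j))) (allFin n))

-- The sensitivity of a function with a (nonempty) profile is the larger of
-- the two peaks: every s(f;x) is bounded by a peak, and both peaks occur.
sensitivity-normalForm : ∀ {n} k rest → All (1 ≤_) (k ∷ rest) → sum (k ∷ rest) ≡ n →
  (σ : Permutation′ n) (a : Fin n → Bool) (b : Bool) (f : BoolFun n) →
  (∀ x → f x ≡ normalForm (k ∷ rest) σ a b x) →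
  sensitivity f ≡ peak (k ∷ rest) true ⊔ peak (k ∷ rest) false
sensitivity-normalForm k rest pos total σ a b f hf =
  ≤-antisym (sensitivity-≤ f upper) (⊔-lub (attained true) (attained false))
  where
  ks = k ∷ rest
  local : ∀ x → sensAt f x ≡ listSens (nest ks) (tabulate (layerInput σ a x))
  local = sensAt-layers σ a b (nest ks) f (λ x → trans (hf x) (normalForm-layers ks σ a b x))
  upper : ∀ x → sensAt f x ≤ peak ks true ⊔ peak ks false
  upper x = ≤-trans (≤-reflexive (local x))
    (≤-trans (nest-sens-bound ks pos v (trans (length-tabulate _) (sym total))) (peak≤ (nest ks v)))
    where
    v = tabulate (layerInput σ a x)
    peak≤ : ∀ c → peak ks c ≤ peak ks true ⊔ peak ks false
    peak≤ true  = m≤m⊔n _ _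
    peak≤ false = m≤n⊔m _ _
  attained : ∀ c → peak ks c ≤ sensitivity f
  attained c with nest-sens-attained k rest pos c
  ... | v , lv , _ , sens with layerInput-onto σ a v (trans lv total)
  ... | x , xv =
    ≤-trans (≤-reflexive (trans (sym sens) (trans (cong (listSens (nest ks)) (sym xv)) (sym (local x)))))
      (sensAt≤sensitivity f (λ e → trans (hf _) (trans (normalForm-resp ks σ a b e) (sym (hf _)))) x)

-- The peaks are the alternating layer sums k₁ + k₃ + ⋯ and k₂ + k₄ + ⋯;
-- whichever sum does not contain the last layer gets an extra 1.
peak-parity : ∀ ks →
  if isOddLength ks then peak ks true ≡ oddSum ks × peak ks false ≡ suc (evenSum ks)
                    else peak ks true ≡ suc (oddSum ks) × peak ks false ≡ evenSum ks
peak-parity []       = refl , refl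
peak-parity (k ∷ ks) with isOddLength ks | peak-parity ks
... | true  | pt , pf = trans (cong (k +_) pf) (+-suc k _) , pt
... | false | pt , pf = cong (k +_) pf , pt

sensFormula-peak : ∀ ks → sensFormula ks ≡ peak ks true ⊔ peak ks false
sensFormula-peak ks with isOddLength ks | peak-parity ks
... | true  | pt , pf = sym (cong₂ _⊔_ pt pf)
... | false | pt , pf = sym (cong₂ _⊔_ pt pf)

-- With a single layer the function is a shifted conjunction of all n ≥ 2
-- variables, sensitive everywhere at its true point.
peak-single : ∀ ks → length ks ≡ 1 → LastAtLeast2 ks → peak ks true ⊔ peak ks false ≡ sum ks
peak-single (k ∷ []) refl 2≤k = m≥n⇒m⊔n≡m (≤-trans (s≤s z≤n) (≤-trans 2≤k (m≤m+n k 0)))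

theorem3p1 : (n : ℕ) → 2 ≤ n → (f : BoolFun n) → IsNCF f →
    (ks : List ℕ) → HasProfile f ks →
    (length ks ≡ 1 → sensitivity f ≡ n) × (2 ≤ length ks → sensitivity f ≡ sensFormula ks)
theorem3p1 n _ f _ []         ((_ , () , _) , _)
theorem3p1 n _ f _ (k ∷ rest) ((pos , last , total) , σ , a , b , hf) =
    (λ one → trans s≡peak (trans (peak-single (k ∷ rest) one last) total))
  , (λ _ → trans s≡peak (sym (sensFormula-peak (k ∷ rest))))
  where
  s≡peak : sensitivity f ≡ peak (k ∷ rest) true ⊔ peak (k ∷ rest) false
  s≡peak = sensitivity-normalForm k rest pos total σ a b f hf
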